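{- Both rules $(\text{AND})_l$ and $(\text{AND})_l^{con}$ are invalid for $\alpha$RJ-consequence. That is: (a) there exist data as in the context (hypotheses, data variables, probability $P$, thresholds $\alpha_i$, operators $t_{H}$), formulas $\gamma,\delta\in\mathrm{Fm}_{\mathcal D}$ with $\neg\gamma,\neg\delta\models\bot$, a finite multiset $\Delta$ and $\varphi\in\mathrm{Fm}_{\mathcal H}$ such that $\Delta,\gamma,\delta\mid\hspace{ -2.4pt}\sim_{\alpha RJ}\varphi$ but $\Delta,\gamma\wedge\delta\not\mid\hspace{ -2.4pt}\sim_{\alpha RJ}\varphi$; and (b) there exist such data, $\gamma,\delta$ with $\neg\gamma,\neg\delta\models\bot$, $\Delta$ and $\varphi$ such that $\Delta,\gamma\wedge\delta\mid\hspace{ -2.4pt}\sim_{\alpha RJ}\varphi$ but $\Delta,\gamma,\delta\not\mid\hspace{ -2.4pt}\sim_{\alpha RJ}\varphi$.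
   Context: $\mathcal H=\{H_1,\dots,H_n\}$ and $\mathcal D=\{d_1,\dots,d_l\}$ are finite sets of propositional variables (not necessarily disjoint); $\mathrm{Fm}_{\mathcal H}$, $\mathrm{Fm}_{\mathcal D}$ are the classical propositional formulas over them built with $\wedge,\vee,\neg$, and $\mathrm{Fm}$ the formulas over $\mathcal H\cup\mathcal D$; $\models$ is classical consequence, $\bot$ a contradiction. $T:=\bigvee_{H\in\mathcal H}H\wedge\bigwedge_{H\neq H'}(H\rightarrow\neg H')$. Let $P$ be a probability function on $\mathrm{Fm}$ with $P(T\wedge H)>0$ for every $H\in\mathcal H$, and $P(\theta\mid\chi)=P(\theta\wedge\chi)/P(\chi)$. For each $H\in\mathcal H$ let $t_H:\mathrm{Fm}_{\mathcal D}\to\mathrm{Fm}_{\mathcal D}$ satisfy $\delta\models t_H(\delta)$; $\gamma\models\delta$ implies $t_H(\gamma)\models t_H(\delta)$; and $t_H(t_H(\delta))\models t_H(\delta)$. Fix thresholds $\alpha_i\in[0,1)$ for each $H_i$. For $\delta\in\mathrm{Fm}_{\mathcal D}$ let $r^\alpha_\delta(H_i)=1-P(t_{H_i}(\delta)\mid T\wedge H_i)$ if $P(t_{H_i}(\delta)\mid T\wedge H_i)\le\alpha_i$, and $r^\alpha_\delta(H_i)=0$ otherwise; for a finite multiset $\Delta$ let $r^\alpha_\Delta(H)=\sum_{\delta\in\Delta}r^\alpha_\delta(H)$ (over occurrences). Let $\hat{\mathcal H}_\Delta$ be the set of $H\in\mathcal H$ minimizing $r^\alpha_\Delta(H)$.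 Then $\Delta\mid\hspace{ -2.4pt}\sim_{\alpha RJ}\varphi$ (for $\varphi\in\mathrm{Fm}_{\mathcal H}$) iff $T,H\models\varphi$ for every $H\in\hat{\mathcal H}_\Delta$. "$\Delta,\gamma$" denotes $\Delta$ with one more occurrence of $\gamma$. -}

module Defs where

open import Data.Nat using (ℕ)
open import Data.Bool using (Bool; true; false; _∧_; _∨_; not; T)
open import Data.Fin using (Fin)
open import Data.List using (List; []; _∷_; map; foldr; concatMap; allFin)
open import Data.Sum using (_⊎_)
open import Data.Unit using () renaming (⊤ to Unit)
open import Data.List.Relation.Unary.All using (All)
open import Data.Product using (Σ; ∃; _×_; _,_)
open import Data.Empty using (⊥)
open import Relation.Nullary using (¬_; yes; no)
open import Relation.Binary.PropositionalEquality using (_≡_; _≢_)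
open import Data.Rational using (ℚ; 0ℚ; 1ℚ; _≤_; _<_; _+_; _-_; _*_; _÷_; ≢-nonZero)
open import Data.Rational.Properties using (_≟_; _≤?_)
open import Data.Fin.Properties using () renaming (_≟_ to _≟F_)
open import Function.Definitions using (Injective)

data Form : Set where
  var  : ℕ → Form
  ⊥f   : Form
  _∧f_ : Form → Form → Form
  _∨f_ : Form → Form → Form
  ¬f_  : Form → Form

⊤f : Form
⊤f = ¬f ⊥f

_⇒f_ : Form → Form → Form
a ⇒f b = (¬f a) ∨f b

-- all variables of a formula satisfy S  (formula lies in Fm_S)
InFm : (ℕ → Set) → Form → Set
InFm S (var x)  = S x
InFm S ⊥f       = Unit
InFm S (a ∧f b) = InFm S a × InFm S b
InFm S (a ∨f b) = InFm S a × InFm S b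
InFm S (¬f a)   = InFm S a

Valuation : Set
Valuation = ℕ → Bool

eval : Valuation → Form → Bool
eval v (var x)  = v x
eval v ⊥f       = false
eval v (a ∧f b) = eval v a ∧ eval v b
eval v (a ∨f b) = eval v a ∨ eval v b
eval v (¬f a)   = not (eval v a)

_⊨_ : List Form → Form → Set
Γ ⊨ φ = (v : Valuation) → All (λ ψ → T (eval v ψ)) Γ → T (eval v φ)

⋁ : List Form → Form
⋁ = foldr _∨f_ ⊥f

⋀ : List Form → Form
⋀ = foldr _∧f_ ⊤f

-- Probability function on Fm_S (values in ℚ ∩ [0,1]); Paris' axioms.

record IsProbability (S : ℕ → Set) (P : Form → ℚ) : Set where
  field
    nonneg : ∀ θ → InFm S θ → 0ℚ ≤ P θ
    le1    : ∀ θ → InFm S θ → P θ ≤ 1ℚ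
    P1     : ∀ θ → InFm S θ → [] ⊨ θ → P θ ≡ 1ℚ
    P2     : ∀ θ φ → InFm S θ → InFm S φ → (θ ∷ []) ⊨ (¬f φ) →
             P (θ ∨f φ) ≡ P θ + P φ

-- (total) division: only ever used with nonzero divisor
div : ℚ → ℚ → ℚ
div p q with q ≟ 0ℚ
... | yes _  = 0ℚ
... | no q≢0 = _÷_ p q {{≢-nonZero q≢0}}

cond : (Form → ℚ) → Form → Form → ℚ
cond P θ χ = div (P (θ ∧f χ)) (P χ)

InImg : ∀ {k} → (Fin k → ℕ) → ℕ → Set
InImg f x = ∃ λ i → f i ≡ x

InEither : (ℕ → Set) → (ℕ → Set) → ℕ → Set
InEither A B x = A x ⊎ B x

TForm : (n : ℕ) → (Fin n → ℕ) → Form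
TForm n H = ⋁ (map (λ i → var (H i)) (allFin n))
            ∧f ⋀ (concatMap (λ i → map (λ j → pair i j) (allFin n)) (allFin n))
  where
  pair : Fin n → Fin n → Form
  pair i j with i ≟F j
  ... | yes _ = ⊤f
  ... | no _  = var (H i) ⇒f (¬f var (H j))

record Setting : Set₁ where
  field
    n  : ℕ
    H  : Fin n → ℕ
    H-inj : Injective _≡_ _≡_ H
    l  : ℕ
    d  : Fin l → ℕ
    P  : Form → ℚ
    α  : Fin n → ℚ
    t  : Fin n → Form → Form
    P-prob  : IsProbability (InEither (InImg H) (InImg d)) P
    P-pos   : ∀ i → 0ℚ < P (TForm n H ∧f var (H i))
    α-nonneg : ∀ i → 0ℚ ≤ α i
    α-lt1   : ∀ i → α i < 1ℚ
    t-Fm    : ∀ i δ → InFm (InImg d) δ → InFm (InImg d) (t i δ)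
    t-ext   : ∀ i δ → InFm (InImg d) δ → (δ ∷ []) ⊨ t i δ
    t-mono  : ∀ i γ δ → InFm (InImg d) γ → InFm (InImg d) δ → (γ ∷ []) ⊨ δ →
              (t i γ ∷ []) ⊨ t i δ
    t-idem  : ∀ i δ → InFm (InImg d) δ → (t i (t i δ) ∷ []) ⊨ t i δ

  InH : ℕ → Set
  InH = InImg H

  InD : ℕ → Set
  InD = InImg d

  Tf : Form
  Tf = TForm n H

  r : Form → Fin n → ℚ
  r δ i with cond P (t i δ) (Tf ∧f var (H i)) ≤? α i
  ... | yes _ = 1ℚ - cond P (t i δ) (Tf ∧f var (H i))
  ... | no _  = 0ℚ

  -- r^α_Δ(H_i), Δ a finite multiset represented as a list (sum over occurrences)
  rΔ : List Form → Fin n → ℚ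
  rΔ Δ i = foldr (λ δ s → r δ i + s) 0ℚ Δ

  Minimal : List Form → Fin n → Set
  Minimal Δ i = ∀ j → rΔ Δ i ≤ rΔ Δ j

  _|~_ : List Form → Form → Set
  Δ |~ φ = ∀ i → Minimal Δ i → (Tf ∷ var (H i) ∷ []) ⊨ φ

Admissible : (S : Setting) → Form → Form → List Form → Form → Set
Admissible S γ δ Δ φ =
  InFm InD γ × InFm InD δ × All (InFm InD) Δ × InFm InH φ ×
  ((¬f γ) ∷ (¬f δ) ∷ []) ⊨ ⊥f
  where open Setting S

-- Finitely supported probability functions make it easy to realise a
-- counter-model.  Take two hypotheses H₀, H₁, data variables d, e, the
-- identity as every t_H, thresholds α₀ = 0, α₁ = ½, and put mass ¼ on
-- {H₀, d}, ¼ on {H₀} and ½ on {H₁, d, e}.  The contradiction d ∧ ¬d is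
-- rejected by both hypotheses with score 1, whereas of d and ¬d only ¬d is
-- rejected, and only by H₁.  Hence {d, ¬d} (scores 0, 1) singles out H₀
-- while {d ∧ ¬d} (scores 1, 1) ties H₀ with H₁, refuting (AND)ₗ.  An extra
-- datum e, rejected by H₀ alone, adds 1 to the score of H₀: now {d ∧ ¬d, e}
-- singles out H₁ while {d, ¬d, e} ties them, refuting (AND)ₗ^con.
module Submission where

open import Defs
open import Algebra.Bundles using (CommutativeMonoid)
open import Data.Bool using (Bool; true; false; if_then_else_; _∨_; not; T)
open import Data.Fin using (Fin; zero; suc)
open import Data.List using (List; []; _∷_)
open import Data.List.Relation.Unary.All using (All; []; _∷_; head)
open import Data.Nat using (ℕ)
open import Data.Product using (Σ; _×_; _,_; proj₁)
open import Data.Rational using (ℚ; 0ℚ; 1ℚ; ½; _≤_; _<_; _+_; _*_)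
open import Data.Rational.Properties
  using (_≤?_; _<?_; ≤-refl; +-mono-≤; +-identityˡ; +-identityʳ; +-0-commutativeMonoid)
open import Data.Unit using (tt)
open import Relation.Binary.PropositionalEquality
  using (_≡_; refl; sym; cong; cong₂; subst; module ≡-Reasoning)
open import Relation.Nullary using (¬_)
open import Relation.Nullary.Decidable using (True; False; toWitness; toWitnessFalse)
open import Algebra.Properties.CommutativeSemigroup
  (CommutativeMonoid.commutativeSemigroup +-0-commutativeMonoid) using (interchange)

decide-≤ : ∀ {p q} {_ : True (p ≤? q)} → p ≤ q
decide-≤ {_} {_} {p≤q} = toWitness p≤q

decide-< : ∀ {p q} {_ : True (p <? q)} → p < q
decide-< {_} {_} {p<q} = toWitness p<q

decide-≰ : ∀ {p q} {_ : False (p ≤? q)} → ¬ p ≤ q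
decide-≰ {_} {_} {p≰q} = toWitnessFalse p≰q

tautology-true : ∀ {θ} → [] ⊨ θ → ∀ v → eval v θ ≡ true
tautology-true {θ} ⊨θ v with eval v θ | ⊨θ v []
... | true | _ = refl

WeightedValuations : Set
WeightedValuations = List (ℚ × Valuation)

weightIf : Bool → ℚ → ℚ
weightIf b c = if b then c else 0ℚ

mass : WeightedValuations → Form → ℚ
mass []             θ = 0ℚ
mass ((c , v) ∷ ws) θ = weightIf (eval v θ) c + mass ws θ

NonNegativeWeights : WeightedValuations → Set
NonNegativeWeights = All (λ w → 0ℚ ≤ proj₁ w)

weightIf-nonneg : ∀ {c} → 0ℚ ≤ c → ∀ b → 0ℚ ≤ weightIf b c
weightIf-nonneg 0≤c true  = 0≤c
weightIf-nonneg 0≤c false = ≤-refl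

weightIf-≤ : ∀ {c} → 0ℚ ≤ c → ∀ b → weightIf b c ≤ c
weightIf-≤ 0≤c true  = ≤-refl
weightIf-≤ 0≤c false = 0≤c

weightIf-∨ : ∀ c a b → (T a → T (not b)) → weightIf (a ∨ b) c ≡ weightIf a c + weightIf b c
weightIf-∨ c true  true  disjoint with () ← disjoint tt
weightIf-∨ c true  false _ = sym (+-identityʳ c)
weightIf-∨ c false true  _ = sym (+-identityˡ c)
weightIf-∨ c false false _ = refl

mass-nonneg : ∀ {ws} → NonNegativeWeights ws → ∀ θ → 0ℚ ≤ mass ws θ
mass-nonneg []                         θ = ≤-refl
mass-nonneg {(c , v) ∷ _} (0≤c ∷ 0≤ws) θ =
  +-mono-≤ (weightIf-nonneg 0≤c (eval v θ)) (mass-nonneg 0≤ws θ)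

mass-≤-mass-⊤ : ∀ {ws} → NonNegativeWeights ws → ∀ θ → mass ws θ ≤ mass ws ⊤f
mass-≤-mass-⊤ []                         θ = ≤-refl
mass-≤-mass-⊤ {(c , v) ∷ _} (0≤c ∷ 0≤ws) θ =
  +-mono-≤ (weightIf-≤ 0≤c (eval v θ)) (mass-≤-mass-⊤ 0≤ws θ)

mass-tautology : ∀ ws {θ} → [] ⊨ θ → mass ws θ ≡ mass ws ⊤f
mass-tautology []             ⊨θ = refl
mass-tautology ((c , v) ∷ ws) {θ} ⊨θ =
  cong₂ _+_ (cong (λ b → weightIf b c) (tautology-true {θ} ⊨θ v)) (mass-tautology ws {θ} ⊨θ)

mass-∨ : ∀ ws {θ φ} → (θ ∷ []) ⊨ (¬f φ) → mass ws (θ ∨f φ) ≡ mass ws θ + mass ws φ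
mass-∨ []             θ⊨¬φ = refl
mass-∨ ((c , v) ∷ ws) {θ} {φ} θ⊨¬φ =
  begin
    weightIf (eval v θ ∨ eval v φ) c + mass ws (θ ∨f φ)
  ≡⟨ cong₂ _+_ (weightIf-∨ c _ _ (λ vθ → θ⊨¬φ v (vθ ∷ []))) (mass-∨ ws {θ} {φ} θ⊨¬φ) ⟩
    (weightIf (eval v θ) c + weightIf (eval v φ) c) + (mass ws θ + mass ws φ)
  ≡⟨ interchange (weightIf (eval v θ) c) (weightIf (eval v φ) c) (mass ws θ) (mass ws φ) ⟩
    (weightIf (eval v θ) c + mass ws θ) + (weightIf (eval v φ) c + mass ws φ)
  ∎
  where open ≡-Reasoning

mass-isProbability : ∀ {S} ws → NonNegativeWeights ws → mass ws ⊤f ≡ 1ℚ →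
                     IsProbability S (mass ws)
mass-isProbability ws 0≤ws total≡1 = record
  { nonneg = λ θ _ → mass-nonneg 0≤ws θ
  ; le1    = λ θ _ → subst (mass ws θ ≤_) total≡1 (mass-≤-mass-⊤ 0≤ws θ)
  ; P1     = λ θ _ ⊨θ → subst (mass ws θ ≡_) total≡1 (mass-tautology ws ⊨θ)
  ; P2     = λ θ φ _ _ → mass-∨ ws
  }

module _ (S : Setting) where
  open Setting S

  |~-unique-minimiser : ∀ {Δ i₀} → (∀ i → Minimal Δ i → i ≡ i₀) → Δ |~ var (H i₀)
  |~-unique-minimiser unique i minimal v (_ ∷ Hᵢ ∷ []) =
    subst (λ j → T (v (H j))) (unique i minimal) Hᵢ

hypothesis : Fin 2 → ℕ
hypothesis zero       = 0
hypothesis (suc zero) = 1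

hypothesis-injective : ∀ {i j} → hypothesis i ≡ hypothesis j → i ≡ j
hypothesis-injective {zero}     {zero}     _  = refl
hypothesis-injective {zero}     {suc zero} ()
hypothesis-injective {suc zero} {zero}     ()
hypothesis-injective {suc zero} {suc zero} _  = refl

datum : Fin 2 → ℕ
datum zero       = 2
datum (suc zero) = 3

d e : Form
d = var 2
e = var 3

only-H₀-d only-H₀ only-H₁-d-e : Valuation
only-H₀-d 0 = true
only-H₀-d 2 = true
only-H₀-d _ = false
only-H₀ 0 = true
only-H₀ _ = false
only-H₁-d-e 1 = true
only-H₁-d-e 2 = true
only-H₁-d-e 3 = true
only-H₁-d-e _ = false

worlds : WeightedValuations
worlds = (½ * ½ , only-H₀-d) ∷ (½ * ½ , only-H₀) ∷ (½ , only-H₁-d-e) ∷ []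

threshold : Fin 2 → ℚ
threshold zero       = 0ℚ
threshold (suc zero) = ½

model : Setting
model = record
  { n        = 2
  ; H        = hypothesis
  ; H-inj    = hypothesis-injective
  ; l        = 2
  ; d        = datum
  ; P        = mass worlds
  ; α        = threshold
  ; t        = λ _ δ → δ
  ; P-prob   = mass-isProbability worlds (decide-≤ ∷ decide-≤ ∷ decide-≤ ∷ []) refl
  ; P-pos    = λ { zero → decide-< ; (suc zero) → decide-< }
  ; α-nonneg = λ { zero → decide-≤ ; (suc zero) → decide-≤ }
  ; α-lt1    = λ { zero → decide-< ; (suc zero) → decide-< }
  ; t-Fm     = λ _ _ δ∈D → δ∈D
  ; t-ext    = λ _ _ _ _ → head
  ; t-mono   = λ _ _ _ _ _ γ⊨δ → γ⊨δ
  ; t-idem   = λ _ _ _ _ → head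
  }

open Setting model using (Minimal; _|~_; Tf)

admissible : ∀ {Δ φ} → All (InFm (Setting.InD model)) Δ → InFm (Setting.InH model) φ →
             Admissible model d (¬f d) Δ φ
admissible Δ⊆D φ∈H = (zero , refl) , (zero , refl) , Δ⊆D , φ∈H , excluded-middle
  where
  excluded-middle : (¬f d ∷ ¬f ¬f d ∷ []) ⊨ ⊥f
  excluded-middle v (_ ∷ _ ∷ []) with v 2
  excluded-middle v (() ∷ _ ∷ []) | true
  excluded-middle v (_ ∷ () ∷ []) | false

T,H₁⊭H₀ : ¬ ((Tf ∷ var 1 ∷ []) ⊨ var 0)
T,H₁⊭H₀ T,H₁⊨H₀ = T,H₁⊨H₀ only-H₁-d-e (tt ∷ tt ∷ [])

T,H₀⊭H₁ : ¬ ((Tf ∷ var 0 ∷ []) ⊨ var 1)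
T,H₀⊭H₁ T,H₀⊨H₁ = T,H₀⊨H₁ only-H₀-d (tt ∷ tt ∷ [])

-- The scores rΔ in the model are closed rationals, so each comparison is
-- decided by evaluation.
d,¬d-minimal-only-H₀ : ∀ i → Minimal (d ∷ ¬f d ∷ []) i → i ≡ zero
d,¬d-minimal-only-H₀ zero       _       = refl
d,¬d-minimal-only-H₀ (suc zero) minimal with () ← decide-≰ (minimal zero)

d∧¬d-minimal-H₁ : Minimal ((d ∧f (¬f d)) ∷ []) (suc zero)
d∧¬d-minimal-H₁ = λ { zero → decide-≤ ; (suc zero) → decide-≤ }

d∧¬d,e-minimal-only-H₁ : ∀ i → Minimal ((d ∧f (¬f d)) ∷ e ∷ []) i → i ≡ suc zero
d∧¬d,e-minimal-only-H₁ zero       minimal with () ← decide-≰ (minimal (suc zero))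
d∧¬d,e-minimal-only-H₁ (suc zero) _       = refl

d,¬d,e-minimal-H₀ : Minimal (d ∷ ¬f d ∷ e ∷ []) zero
d,¬d,e-minimal-H₀ = λ { zero → decide-≤ ; (suc zero) → decide-≤ }

proposition6 :
    (Σ Setting λ S → Σ Form λ γ → Σ Form λ δ → Σ (List Form) λ Δ → Σ Form λ φ →
        Admissible S γ δ Δ φ ×
        Setting._|~_ S (γ ∷ δ ∷ Δ) φ × ¬ Setting._|~_ S ((γ ∧f δ) ∷ Δ) φ)
    ×
    (Σ Setting λ S → Σ Form λ γ → Σ Form λ δ → Σ (List Form) λ Δ → Σ Form λ φ →
        Admissible S γ δ Δ φ ×
        Setting._|~_ S ((γ ∧f δ) ∷ Δ) φ × ¬ Setting._|~_ S (γ ∷ δ ∷ Δ) φ)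
proposition6 =
  ( model , d , ¬f d , [] , var 0
  , admissible {[]} {var 0} [] (zero , refl)
  , |~-unique-minimiser model {d ∷ ¬f d ∷ []} d,¬d-minimal-only-H₀
  , (λ |~H₀ → T,H₁⊭H₀ (|~H₀ (suc zero) d∧¬d-minimal-H₁)) )
  ,
  ( model , d , ¬f d , e ∷ [] , var 1
  , admissible {e ∷ []} {var 1} ((suc zero , refl) ∷ []) (suc zero , refl)
  , |~-unique-minimiser model {(d ∧f (¬f d)) ∷ e ∷ []} d∧¬d,e-minimal-only-H₁
  , (λ |~H₁ → T,H₀⊭H₁ (|~H₁ zero d,¬d,e-minimal-H₀)) )
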